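{- Let $m\ge 2$ be an integer and $k=5m+2$. Then $va_3^{\equiv}(K_{4k+2,4k+2,4k+2})\leq 12m+3$.
   Context: All graphs are finite and simple. A $t$-coloring of a graph $G$ is a map $f:V(G)\to\{1,\dots,t\}$, with color classes $V_i=\{v: f(v)=i\}$. It is equitable if $\big||V_i|-|V_j|\big|\le 1$ for all $i,j$. A $(t,k)$-tree-coloring of $G$ is a $t$-coloring such that every connected component of each induced subgraph $G[V_i]$ is a tree of maximum degree at most $k$; an equitable $(t,k)$-tree-coloring is a $(t,k)$-tree-coloring that is equitable. The strong equitable vertex $k$-arboricity $va_k^{\equiv}(G)$ is the smallest integer $t$ such that $G$ has an equitable $(t',k)$-tree-coloring for every integer $t'\ge t$. $K_{n,n,n}$ denotes the complete tripartite graph whose three partite sets each have exactly $n$ vertices. -}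

module Defs where

open import Data.Nat using (ℕ; zero; suc; _+_; _*_; _≤_)
open import Data.Bool using (Bool; true; false; not; T)
open import Data.Fin using (Fin; zero; suc; inject₁; fromℕ; quotient)
open import Data.Fin.Properties using (_≟_)
open import Data.List using (List; length; filter)
open import Data.List.Base using (allFin)
open import Data.Product using (Σ; _×_; _,_; ∃-syntax)
open import Relation.Binary.PropositionalEquality using (_≡_)
open import Relation.Nullary using (¬_)
open import Relation.Nullary.Decidable using (⌊_⌋)
open import Function.Definitions using (Injective)

record Graph : Set where
  field
    n      : ℕ
    adj    : Fin n → Fin n → Bool
    sym    : ∀ u v → adj u v ≡ adj v u
    irrefl : ∀ v → adj v v ≡ false
open Graph public

classSize : (G : Graph) {t : ℕ} → (Fin (n G) → Fin t) → Fin t → ℕ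
classSize G f i = length (filter (λ v → f v ≟ i) (allFin (n G)))

Equitable : (G : Graph) {t : ℕ} → (Fin (n G) → Fin t) → Set
Equitable G f = ∀ i j → classSize G f i ≤ classSize G f j + 1

colourDegree : (G : Graph) {t : ℕ} → (Fin (n G) → Fin t) → Fin (n G) → ℕ
colourDegree G f v =
  length (filter (λ u → Data.Bool._≟_ (adj G v u) true) (filter (λ u → f u ≟ f v) (allFin (n G))))

-- a cycle of length l + 3 in G, all of whose vertices get colour i
MonoCycle : (G : Graph) {t : ℕ} → (Fin (n G) → Fin t) → Fin t → ℕ → Set
MonoCycle G f i l =
  Σ (Fin (3 + l) → Fin (n G)) λ c →
    Injective _≡_ _≡_ c
    × (∀ j → f (c j) ≡ i)
    × (∀ (j : Fin (2 + l)) → T (adj G (c (inject₁ j)) (c (suc j))))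
    × T (adj G (c (fromℕ (2 + l))) (c zero))

-- (t,k)-tree-colouring: every component of every G[V_i] is a tree of
-- maximum degree ≤ k, i.e. each G[V_i] is acyclic (a forest) and has
-- maximum degree ≤ k.
TreeColouring : (G : Graph) (t k : ℕ) → (Fin (n G) → Fin t) → Set
TreeColouring G t k f =
  (∀ i l → ¬ MonoCycle G f i l) × (∀ v → colourDegree G f v ≤ k)

HasEqTreeColouring : Graph → ℕ → ℕ → Set
HasEqTreeColouring G t k =
  Σ (Fin (n G) → Fin t) λ f → TreeColouring G t k f × Equitable G f

StrongEqProperty : Graph → ℕ → ℕ → Set
StrongEqProperty G k t = ∀ t' → t ≤ t' → HasEqTreeColouring G t' k

-- va_k^≡(G) ≤ b : the least t with StrongEqProperty is at most b,
-- i.e. some t ≤ b has the property.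
StrongEqVertexArboricity≤ : Graph → ℕ → ℕ → Set
StrongEqVertexArboricity≤ G k b = ∃[ t ] (t ≤ b × StrongEqProperty G k t)

-- complete tripartite graph K_{p,p,p}: vertex v ∈ Fin (3 * p) lies in part
-- quotient p v ∈ Fin 3; two vertices are adjacent iff parts differ.
part : (p : ℕ) → Fin (3 * p) → Fin 3
part p v = quotient {3} p v

K3 : ℕ → Graph
K3 p = record
  { n = 3 * p
  ; adj = λ u v → not ⌊ part p u ≟ part p v ⌋
  ; sym = λ u v → symLemma (part p u) (part p v)
  ; irrefl = λ v → irrLemma (part p v)
  }
  where
  symLemma : (a b : Fin 3) → not ⌊ a ≟ b ⌋ ≡ not ⌊ b ≟ a ⌋
  symLemma zero zero = Relation.Binary.PropositionalEquality.refl
  symLemma zero (suc zero) = Relation.Binary.PropositionalEquality.refl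
  symLemma zero (suc (suc zero)) = Relation.Binary.PropositionalEquality.refl
  symLemma (suc zero) zero = Relation.Binary.PropositionalEquality.refl
  symLemma (suc zero) (suc zero) = Relation.Binary.PropositionalEquality.refl
  symLemma (suc zero) (suc (suc zero)) = Relation.Binary.PropositionalEquality.refl
  symLemma (suc (suc zero)) zero = Relation.Binary.PropositionalEquality.refl
  symLemma (suc (suc zero)) (suc zero) = Relation.Binary.PropositionalEquality.refl
  symLemma (suc (suc zero)) (suc (suc zero)) = Relation.Binary.PropositionalEquality.refl
  irrLemma : (a : Fin 3) → not ⌊ a ≟ a ⌋ ≡ false
  irrLemma zero = Relation.Binary.PropositionalEquality.refl
  irrLemma (suc zero) = Relation.Binary.PropositionalEquality.refl
  irrLemma (suc (suc zero)) = Relation.Binary.PropositionalEquality.refl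

module Submission where

-- The vertices of K_{p,p,p} are the positions 0, …, 3p − 1, part q being [qp, (q+1)p). We colour
-- by cutting this range into consecutive blocks whose lengths differ by at most one, which makes
-- the colouring equitable. A block inside one part is independent, and a block of at most four
-- vertices whose first (or last) vertex is alone on its side of a part boundary induces a star
-- K_{1,≤3}; both are forests of maximum degree at most 3, and blocks of at most three vertices
-- are of one of these kinds wherever they lie. For p = 4k + 2 with k = 5m + 2 every t ≥ 12m + 3
-- admits such a cutting: blocks of sizes 5, 6 or 4, 5 fitted inside the parts for t ≤ 3k, one
-- layout with two 4-blocks straddling part boundaries for t = 3k + 1, 4-blocks inside the parts
-- separated by runs of 3-blocks for 3k + 2 ≤ t ≤ p, and blocks of size at most 3 for t > p.

open import Defs hiding (sym)
open import Data.Bool using (Bool; true; false; T; not; if_then_else_)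
open import Data.Bool.Properties using (T-≡)
open import Data.Fin using (Fin; zero; suc; toℕ; fromℕ<; inject₁; fromℕ; remainder)
import Data.Fin.Properties as Finₚ
open import Data.List using (List; []; _∷_; [_]; length; filter; tabulate; lookup; _++_; replicate; map)
open import Data.List.Base using (allFin)
open import Data.List.Properties using (length-++; length-replicate)
open import Data.List.Membership.Propositional.Properties using (∈-lookup)
open import Data.List.Relation.Unary.All as All using (All)
import Data.List.Relation.Unary.All.Properties as Allₚ
open import Data.Nat
open import Data.Nat.Properties
open import Data.Nat.DivMod using (_/_; _%_; m≡m%n+[m/n]*n; m/n*n≤m; m%n<n; m<n*o⇒m/o<n)
open import Data.Nat.ListAction using (sum)
open import Data.Nat.ListAction.Properties using (sum-++)
open import Data.Nat.Tactic.RingSolver using (solve; solve-∀)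
open import Data.Product using (_×_; _,_; proj₁; proj₂; ∃; ∃-syntax)
open import Data.Sum using (_⊎_; inj₁; inj₂)
open import Data.Unit using (tt)
open import Function using (_∘_)
open import Function.Bundles using (Equivalence; mk⇔)
open import Level using (0ℓ)
open import Relation.Binary.PropositionalEquality hiding ([_])
open import Relation.Nullary using (¬_; yes; no; does; contradiction)
open import Relation.Nullary.Decidable using (_×-dec_; ⌊_⌋; isYes; isYes≗does; toWitness; does-⇔)
open import Relation.Unary using (Pred; Decidable)

count : (ℕ → Bool) → ℕ → ℕ
count h zero    = 0
count h (suc n) = (if h 0 then 1 else 0) + count (h ∘ suc) n

count-+ : ∀ h m n → count h (m + n) ≡ count h m + count (h ∘ (m +_)) n
count-+ h zero    n = refl
count-+ h (suc m) n =
  trans (cong (_ +_) (count-+ (h ∘ suc) m n)) (sym (+-assoc (if h 0 then 1 else 0) _ _))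

count-cong : ∀ {h h′} n → (∀ x → x < n → h x ≡ h′ x) → count h n ≡ count h′ n
count-cong zero    eq = refl
count-cong (suc n) eq =
  cong₂ (λ b c → (if b then 1 else 0) + c) (eq 0 z<s) (count-cong n (λ x x<n → eq (suc x) (s<s x<n)))

count-true : ∀ n → count (λ _ → true) n ≡ n
count-true zero    = refl
count-true (suc n) = cong suc (count-true n)

count-false : ∀ n → count (λ _ → false) n ≡ 0
count-false zero    = refl
count-false (suc n) = count-false n

count-window : ∀ {h} n lo k → (∀ x → T (h x) → lo ≤ x × x < lo + k) → count h n ≤ k
count-window zero    lo k inside = z≤n
count-window {h} (suc n) lo k inside with h 0 in h0 | lo | k
... | false | zero   | k = count-window n 0 k λ x hx → z≤n , <-trans (n<1+n x) (proj₂ (inside (suc x) hx))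
... | false | suc lo | k =
  count-window n lo k λ x hx → let (l , u) = inside (suc x) hx in s≤s⁻¹ l , s≤s⁻¹ u
... | true  | suc lo | k with () ← proj₁ (inside 0 (subst T (sym h0) tt))
... | true  | zero   | zero with () ← proj₂ (inside 0 (subst T (sym h0) tt))
... | true  | zero   | suc k = s≤s (count-window n 0 k λ x hx → z≤n , s≤s⁻¹ (proj₂ (inside (suc x) hx)))

length-filter-tabulate : ∀ {a ℓ} {A : Set a} {P : Pred A ℓ} (P? : Decidable P) n
  (g : Fin n → A) (h : ℕ → Bool) → (∀ i → does (P? (g i)) ≡ h (toℕ i)) →
  length (filter P? (tabulate g)) ≡ count h n
length-filter-tabulate P? zero    g h eq = refl
length-filter-tabulate P? (suc n) g h eq
  with does (P? (g zero)) | h 0 | eq zero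
     | length-filter-tabulate P? n (g ∘ suc) (h ∘ suc) (eq ∘ suc)
... | true  | .true  | refl | ih = cong suc ih
... | false | .false | refl | ih = ih

length-filter-filter-≤ : ∀ {a ℓ} {A : Set a} {P Q R : Pred A ℓ}
  (P? : Decidable P) (Q? : Decidable Q) (R? : Decidable R) → (∀ {x} → P x → Q x → R x) →
  ∀ xs → length (filter Q? (filter P? xs)) ≤ length (filter R? xs)
length-filter-filter-≤ P? Q? R? PQ⇒R [] = z≤n
length-filter-filter-≤ P? Q? R? PQ⇒R (x ∷ xs)
  with ih ← length-filter-filter-≤ P? Q? R? PQ⇒R xs | P? x | R? x
... | no _   | yes _ = m≤n⇒m≤1+n ih
... | no _   | no _  = ih
... | yes px | r with Q? x | r
...   | no _   | yes _  = m≤n⇒m≤1+n ih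
...   | no _   | no _   = ih
...   | yes _  | yes _  = s≤s ih
...   | yes qx | no ¬rx = contradiction (PQ⇒R px qx) ¬rx

m+k≡n⇒m≤n : ∀ {m n} k → m + k ≡ n → m ≤ n
m+k≡n⇒m≤n k refl = m≤m+n _ k

≤-offset : ∀ {m n} → m ≤ n → ∃[ x ] n ≡ m + x
≤-offset {m} {n} m≤n = n ∸ m , sym (m+[n∸m]≡n m≤n)

m<n+o∧n≤m⇒m∸n<o : ∀ {m} n o → m < n + o → n ≤ m → m ∸ n < o
m<n+o∧n≤m⇒m∸n<o n o m<n+o n≤m = +-cancelˡ-< n _ _ (subst (_< n + o) (sym (m+[n∸m]≡n n≤m)) m<n+o)

sum-replicate : ∀ n x → sum (replicate n x) ≡ n * x
sum-replicate zero    x = refl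
sum-replicate (suc n) x = cong (x +_) (sum-replicate n x)

split-into-three : ∀ c d → d ≤ 3 * c →
  ∃[ x ] ∃[ y ] ∃[ z ] (x ≤ c × y ≤ c × z ≤ c) × x + (y + z) ≡ d
split-into-three c d d≤3c =
  c ⊓ d , c ⊓ (d ∸ c) , d ∸ c ∸ c , (m⊓n≤m c d , m⊓n≤m c (d ∸ c) , rest≤c) ,
  trans (cong (c ⊓ d +_) (m⊓n+n∸m≡n c (d ∸ c))) (m⊓n+n∸m≡n c d)
  where
  3c∸c∸c≡c : 3 * c ∸ c ∸ c ≡ c
  3c∸c∸c≡c = trans (cong (_∸ c) (m+n∸m≡n c (c + (c + 0)))) (trans (m+n∸m≡n c (c + 0)) (+-identityʳ c))
  rest≤c : d ∸ c ∸ c ≤ c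
  rest≤c = subst (d ∸ c ∸ c ≤_) 3c∸c∸c≡c (∸-monoˡ-≤ c (∸-monoˡ-≤ c d≤3c))

round-up-to-three : ∀ N → ∃[ Y ] ∃[ δ ] δ ≤ 2 × Y * 3 ≡ N + δ
round-up-to-three zero = 0 , 0 , z≤n , refl
round-up-to-three (suc N) with round-up-to-three N
... | Y , zero  , _         , Y*3≡ = suc Y , 2 , ≤-refl , trans (cong (3 +_) Y*3≡) (solve (N ∷ []))
... | Y , suc δ , s≤s δ≤1 , Y*3≡ = Y , δ , m≤n⇒m≤1+n δ≤1 , trans Y*3≡ (+-suc N δ)

-- Cutting an initial segment of ℕ into consecutive blocks

-- The index of the block containing x; positions x ≥ sum L get the junk index length L.
blockOf : List ℕ → ℕ → ℕ
blockOf []      x = 0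
blockOf (ℓ ∷ L) x with x <? ℓ
... | yes _ = 0
... | no  _ = suc (blockOf L (x ∸ ℓ))

blockStart : (L : List ℕ) → Fin (length L) → ℕ
blockStart (ℓ ∷ L) zero    = 0
blockStart (ℓ ∷ L) (suc i) = ℓ + blockStart L i

blockOf-head : ∀ {ℓ} L {x} → x < ℓ → blockOf (ℓ ∷ L) x ≡ 0
blockOf-head {ℓ} L {x} x<ℓ with x <? ℓ
... | yes _   = refl
... | no  x≮ℓ = contradiction x<ℓ x≮ℓ

blockOf-tail : ∀ ℓ L x → blockOf (ℓ ∷ L) (ℓ + x) ≡ suc (blockOf L x)
blockOf-tail ℓ L x with ℓ + x <? ℓ
... | yes ℓ+x<ℓ = contradiction ℓ+x<ℓ (m+n≮m ℓ x)
... | no  _     = cong (suc ∘ blockOf L) (m+n∸m≡n ℓ x)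

blockOf-< : ∀ L {x} → x < sum L → blockOf L x < length L
blockOf-< (ℓ ∷ L) {x} x<sum with x <? ℓ
... | yes _   = z<s
... | no  x≮ℓ = s<s (blockOf-< L (m<n+o∧n≤m⇒m∸n<o ℓ (sum L) x<sum (≮⇒≥ x≮ℓ)))

count-blockOf : ∀ L i → count (λ x → blockOf L x ≡ᵇ toℕ i) (sum L) ≡ lookup L i
count-blockOf (ℓ ∷ L) i = begin
  count inBlock (ℓ + sum L)
    ≡⟨ count-+ inBlock ℓ (sum L) ⟩
  count inBlock ℓ + count (inBlock ∘ (ℓ +_)) (sum L)
    ≡⟨ cong₂ _+_ (count-cong ℓ λ x x<ℓ → cong (_≡ᵇ toℕ i) (blockOf-head L x<ℓ))
                 (count-cong (sum L) λ x _ → cong (_≡ᵇ toℕ i) (blockOf-tail ℓ L x)) ⟩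
  count (λ _ → 0 ≡ᵇ toℕ i) ℓ + count (λ x → suc (blockOf L x) ≡ᵇ toℕ i) (sum L)
    ≡⟨ by-index i ⟩
  lookup (ℓ ∷ L) i ∎
  where
  open ≡-Reasoning
  inBlock : ℕ → Bool
  inBlock x = blockOf (ℓ ∷ L) x ≡ᵇ toℕ i
  by-index : ∀ i → count (λ _ → 0 ≡ᵇ toℕ i) ℓ + count (λ x → suc (blockOf L x) ≡ᵇ toℕ i) (sum L)
                   ≡ lookup (ℓ ∷ L) i
  by-index zero    = trans (cong₂ _+_ (count-true ℓ) (count-false (sum L))) (+-identityʳ ℓ)
  by-index (suc i) =
    trans (cong (_+ count (λ x → blockOf L x ≡ᵇ toℕ i) (sum L)) (count-false ℓ)) (count-blockOf L i)

blockOf-window : ∀ L i {x} → x < sum L → blockOf L x ≡ toℕ i →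
  blockStart L i ≤ x × x < blockStart L i + lookup L i
blockOf-window (ℓ ∷ L) i {x} x<sum eq with x <? ℓ
blockOf-window (ℓ ∷ L) zero    x<sum eq | yes x<ℓ = z≤n , x<ℓ
blockOf-window (ℓ ∷ L) (suc i) {x} x<sum eq | no x≮ℓ
  with lo , hi ← blockOf-window L i (m<n+o∧n≤m⇒m∸n<o ℓ (sum L) x<sum (≮⇒≥ x≮ℓ)) (suc-injective eq) =
  subst (ℓ + blockStart L i ≤_) ℓ+[x∸ℓ]≡x (+-monoʳ-≤ ℓ lo) ,
  subst₂ _<_ ℓ+[x∸ℓ]≡x (sym (+-assoc ℓ _ _)) (+-monoʳ-< ℓ hi)
  where
  ℓ+[x∸ℓ]≡x : ℓ + (x ∸ ℓ) ≡ x
  ℓ+[x∸ℓ]≡x = m+[n∸m]≡n (≮⇒≥ x≮ℓ)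

-- Star-shaped colour classes

module _ (G : Graph) where

  private
    V = Fin (n G)
    Adj : V → V → Set
    Adj u w = T (adj G u w)

  -- The hub is a position rather than a vertex so that independent classes are stars too.
  record Star (k : ℕ) (M : V → Set) : Set where
    field
      hub    : ℕ
      window : ℕ
      edge-at-hub    : ∀ {u w} → M u → M w → Adj u w → toℕ u ≡ hub ⊎ toℕ w ≡ hub
      hub-neighbours : ∀ {u w} → M u → M w → toℕ u ≡ hub → Adj u w →
                       window ≤ toℕ w × toℕ w < window + k

  private
    ThirdNeighbour : ∀ {l} → (Fin (3 + l) → V) → Set
    ThirdNeighbour c = ∃ λ j → j ≢ suc zero × j ≢ suc (suc zero) × Adj (c (suc (suc zero))) (c j)

    third-neighbour : ∀ l (c : Fin (3 + l) → V) →
      (∀ (j : Fin (2 + l)) → Adj (c (inject₁ j)) (c (suc j))) → Adj (c (fromℕ (2 + l))) (c zero) →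
      ThirdNeighbour c
    third-neighbour zero    c edge close = zero , (λ ()) , (λ ()) , close
    third-neighbour (suc l) c edge close = suc (suc (suc zero)) , (λ ()) , (λ ()) , edge (suc (suc zero))

  -- Both edges at c₁ meet the hub, which forces c₁ to be the hub; then the other edge at c₂ misses it.
  star-acyclic : ∀ {t k} {f : V → Fin t} {i} → Star k (λ v → f v ≡ i) → ∀ l → ¬ MonoCycle G f i l
  star-acyclic S l (c , c-inj , c-col , edge , close) =
    contradiction c₁≡hub (hub-not-at (third-neighbour l c edge close))
    where
    open Star S
    at-hub-unique : ∀ {a b} → toℕ (c a) ≡ hub → toℕ (c b) ≡ hub → a ≡ b
    at-hub-unique ha hb = c-inj (Finₚ.toℕ-injective (trans ha (sym hb)))
    c₁≡hub : toℕ (c (suc zero)) ≡ hub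
    c₁≡hub with edge-at-hub (c-col _) (c-col _) (edge zero) | edge-at-hub (c-col _) (c-col _) (edge (suc zero))
    ... | inj₂ h₁ | _       = h₁
    ... | _       | inj₁ h₁ = h₁
    ... | inj₁ h₀ | inj₂ h₂ with () ← at-hub-unique h₀ h₂
    hub-not-at : ThirdNeighbour c → toℕ (c (suc zero)) ≢ hub
    hub-not-at (j , j≢1 , j≢2 , c₂~cj) h₁ with edge-at-hub (c-col _) (c-col _) c₂~cj
    ... | inj₁ h₂ with () ← at-hub-unique h₁ h₂
    ... | inj₂ hj = j≢1 (at-hub-unique hj h₁)

  private
    window-degree : ∀ {P Q : Pred V 0ℓ} (P? : Decidable P) (Q? : Decidable Q) lo k →
      (∀ {u} → P u → Q u → lo ≤ toℕ u × toℕ u < lo + k) →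
      length (filter Q? (filter P? (allFin (n G)))) ≤ k
    window-degree P? Q? lo k inWindow = begin
      length (filter Q? (filter P? (allFin (n G))))
        ≤⟨ length-filter-filter-≤ P? Q? R? inWindow (allFin (n G)) ⟩
      length (filter R? (allFin (n G)))
        ≡⟨ length-filter-tabulate R? (n G) (λ v → v) r (λ v → sym (isYes≗does (R? v))) ⟩
      count r (n G)
        ≤⟨ count-window (n G) lo k (λ x → toWitness) ⟩
      k ∎
      where
      open ≤-Reasoning
      R? : Decidable λ u → lo ≤ toℕ u × toℕ u < lo + k
      R? u = (lo ≤? toℕ u) ×-dec (toℕ u <? lo + k)
      r : ℕ → Bool
      r x = isYes ((lo ≤? x) ×-dec (x <? lo + k))

  star-degree : ∀ {t k} {f : V → Fin t} v → 1 ≤ k → Star k (λ u → f u ≡ f v) →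
    colourDegree G f v ≤ k
  star-degree {f = f} v 1≤k S with toℕ v ≟ Star.hub S
  ... | yes v-hub = window-degree _ _ (Star.window S) _
                      λ fu v~u → Star.hub-neighbours S refl fu v-hub (Equivalence.from T-≡ v~u)
  ... | no  v≢hub = ≤-trans (window-degree _ _ (Star.hub S) 1 only-hub) 1≤k
    where
    only-hub : ∀ {u} → f u ≡ f v → adj G v u ≡ true → Star.hub S ≤ toℕ u × toℕ u < Star.hub S + 1
    only-hub fu v~u with Star.edge-at-hub S refl fu (Equivalence.from T-≡ v~u)
    ... | inj₁ v-hub = contradiction v-hub v≢hub
    ... | inj₂ u-hub = ≤-reflexive (sym u-hub) , subst (_< Star.hub S + 1) (sym u-hub) (m<m+n _ z<s)

-- Parts of K_{p,p,p} and good blocks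

InPart : (p q x : ℕ) → Set
InPart p q x = q * p ≤ x × x < suc q * p

inPart-unique : ∀ p {q q′ x} → InPart p q x → InPart p q′ x → q ≡ q′
inPart-unique p {q} {q′} (lo , hi) (lo′ , hi′) =
  ≤-antisym (s≤s⁻¹ (*-cancelʳ-< p q (suc q′) (≤-<-trans lo hi′)))
            (s≤s⁻¹ (*-cancelʳ-< p q′ (suc q) (≤-<-trans lo′ hi)))

inPart-part : ∀ p (v : Fin (3 * p)) → InPart p (toℕ (part p v)) (toℕ v)
inPart-part p v = subst (InPart p q) (sym toℕv≡) (lo , hi)
  where
  q r : ℕ
  q = toℕ (part p v)
  r = toℕ (remainder {3} p v)
  toℕv≡ : toℕ v ≡ p * q + r
  toℕv≡ = trans (cong toℕ (sym (Finₚ.combine-remQuot {3} p v)))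
                (Finₚ.toℕ-combine (part p v) (remainder {3} p v))
  lo : q * p ≤ p * q + r
  lo = subst (_≤ p * q + r) (*-comm p q) (m≤m+n (p * q) r)
  hi : p * q + r < suc q * p
  hi = subst (p * q + r <_) (trans (+-comm (p * q) p) (cong (p +_) (*-comm p q)))
             (+-monoʳ-< (p * q) (Finₚ.toℕ<n (remainder {3} p v)))

-- The block covers the positions [a, a + ℓ). leftHub: it starts at the last vertex of part q, its
-- other vertices opening part q + 1; rightHub: it ends at the first vertex of part q + 1, its other
-- vertices closing part q.
data GoodBlock (p a ℓ : ℕ) : Set where
  inPart   : ∀ q → q * p ≤ a → a + ℓ ≤ suc q * p → GoodBlock p a ℓ
  leftHub  : ∀ q → suc a ≡ suc q * p → a + ℓ ≤ suc q * p + 3 → GoodBlock p a ℓ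
  rightHub : ∀ q → a + ℓ ≡ suc (suc q * p) → suc q * p ≤ a + 3 → GoodBlock p a ℓ

module _ {p : ℕ} where

  private
    V = Fin (3 * p)
    Adj : V → V → Set
    Adj u w = T (adj (K3 p) u w)

    distinct-parts : ∀ {m} (a b : Fin m) → T (not ⌊ a Finₚ.≟ b ⌋) → a ≢ b
    distinct-parts a b a≉b a≡b with a Finₚ.≟ b
    ... | no a≢b = a≢b a≡b

  samePart-nonadjacent : ∀ q {u w} → InPart p q (toℕ u) → InPart p q (toℕ w) → ¬ Adj u w
  samePart-nonadjacent q {u} {w} u∈q w∈q u~w = distinct-parts (part p u) (part p w) u~w
    (Finₚ.toℕ-injective (trans (inPart-unique p {q′ = q} (inPart-part p u) u∈q)
                               (sym (inPart-unique p (inPart-part p w) w∈q))))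

  samePosition-nonadjacent : ∀ {u w} → toℕ u ≡ toℕ w → ¬ Adj u w
  samePosition-nonadjacent {u} eq u~w with refl ← Finₚ.toℕ-injective eq =
    subst T (irrefl (K3 p) u) u~w

  independent-star : ∀ {M : V → Set} q → (∀ {v} → M v → InPart p q (toℕ v)) → Star (K3 p) 3 M
  independent-star q inq = record
    { hub = 0 ; window = 0
    ; edge-at-hub    = λ mu mw u~w → contradiction u~w (samePart-nonadjacent q (inq mu) (inq mw))
    ; hub-neighbours = λ mu mw _ u~w → contradiction u~w (samePart-nonadjacent q (inq mu) (inq mw))
    }

  hub-star : ∀ {M : V → Set} c q lo →
    (∀ {v} → M v → toℕ v ≢ c → InPart p q (toℕ v) × lo ≤ toℕ v × toℕ v < lo + 3) →
    Star (K3 p) 3 M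
  hub-star {M} c q lo others = record
    { hub = c ; window = lo ; edge-at-hub = at-hub ; hub-neighbours = neighbours }
    where
    at-hub : ∀ {u w} → M u → M w → Adj u w → toℕ u ≡ c ⊎ toℕ w ≡ c
    at-hub {u} {w} mu mw u~w with toℕ u ≟ c | toℕ w ≟ c
    ... | yes u≡c | _       = inj₁ u≡c
    ... | no _    | yes w≡c = inj₂ w≡c
    ... | no u≢c  | no w≢c  =
      contradiction u~w (samePart-nonadjacent q (proj₁ (others mu u≢c)) (proj₁ (others mw w≢c)))
    neighbours : ∀ {u w} → M u → M w → toℕ u ≡ c → Adj u w → lo ≤ toℕ w × toℕ w < lo + 3
    neighbours mu mw u≡c u~w =
      proj₂ (others mw λ w≡c → samePosition-nonadjacent (trans u≡c (sym w≡c)) u~w)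

  goodBlock-star : 3 ≤ p → ∀ {a ℓ} {M : V → Set} →
    (∀ {v} → M v → a ≤ toℕ v × toℕ v < a + ℓ) → GoodBlock p a ℓ → Star (K3 p) 3 M
  goodBlock-star _ inBlock (inPart q qp≤a end≤) =
    independent-star q λ mv → ≤-trans qp≤a (proj₁ (inBlock mv)) , <-≤-trans (proj₂ (inBlock mv)) end≤
  goodBlock-star 3≤p {a} {ℓ} {M} inBlock (leftHub q a+1≡B end≤) = hub-star a (suc q) (suc a) others
    where
    B+3≤next : suc q * p + 3 ≤ suc (suc q) * p
    B+3≤next = subst (suc q * p + 3 ≤_) (+-comm (suc q * p) p) (+-monoʳ-≤ (suc q * p) 3≤p)
    others : ∀ {v} → M v → toℕ v ≢ a →
             InPart p (suc q) (toℕ v) × suc a ≤ toℕ v × toℕ v < suc a + 3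
    others {v} mv v≢a =
      (subst (_≤ toℕ v) a+1≡B a<v , <-≤-trans v<end (≤-trans end≤ B+3≤next)) ,
      a<v , <-≤-trans v<end (subst (λ B → a + ℓ ≤ B + 3) (sym a+1≡B) end≤)
      where
      v<end : toℕ v < a + ℓ
      v<end = proj₂ (inBlock mv)
      a<v : a < toℕ v
      a<v = ≤∧≢⇒< (proj₁ (inBlock mv)) (v≢a ∘ sym)
  goodBlock-star 3≤p {a} {ℓ} {M} inBlock (rightHub q end≡ B≤a+3) = hub-star (suc q * p) q a others
    where
    qp≤a : q * p ≤ a
    qp≤a = +-cancelʳ-≤ 3 (q * p) a
      (≤-trans (subst (q * p + 3 ≤_) (+-comm (q * p) p) (+-monoʳ-≤ (q * p) 3≤p)) B≤a+3)
    others : ∀ {v} → M v → toℕ v ≢ suc q * p → InPart p q (toℕ v) × a ≤ toℕ v × toℕ v < a + 3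
    others {v} mv v≢B =
      (≤-trans qp≤a (proj₁ (inBlock mv)) , v<B) , proj₁ (inBlock mv) , <-≤-trans v<B B≤a+3
      where
      v<B : toℕ v < suc q * p
      v<B = ≤∧≢⇒< (m<1+n⇒m≤n (subst (toℕ v <_) end≡ (proj₂ (inBlock mv)))) v≢B

-- Tilings and the colourings they induce

data Tiling (p : ℕ) : ℕ → ℕ → List ℕ → Set where
  []  : ∀ {a} → Tiling p a a []
  _∷_ : ∀ {a b ℓ L} → GoodBlock p a ℓ → Tiling p (a + ℓ) b L → Tiling p a b (ℓ ∷ L)

infixr 5 _++ᵗ_
_++ᵗ_ : ∀ {p a b c A B} → Tiling p a b A → Tiling p b c B → Tiling p a c (A ++ B)
[]      ++ᵗ T = T
(g ∷ S) ++ᵗ T = g ∷ (S ++ᵗ T)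

tiling-sum : ∀ {p a b L} → Tiling p a b L → a + sum L ≡ b
tiling-sum {a = a} []                = +-identityʳ a
tiling-sum {a = a} (_∷_ {ℓ = ℓ} g T) = trans (sym (+-assoc a ℓ _)) (tiling-sum T)

tiling-lookup : ∀ {p a b L} → Tiling p a b L → ∀ i → GoodBlock p (a + blockStart L i) (lookup L i)
tiling-lookup {p} {a} (_∷_ {ℓ = ℓ} g T) zero    = subst (λ x → GoodBlock p x ℓ) (sym (+-identityʳ a)) g
tiling-lookup {p} {a} (_∷_ {ℓ = ℓ} {L} g T) (suc i) =
  subst (λ x → GoodBlock p x (lookup L i)) (+-assoc a ℓ _) (tiling-lookup T i)

Balanced : ℕ → List ℕ → Set
Balanced s = All (λ ℓ → s ≤ ℓ × ℓ ≤ suc s)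

record Layout (p t : ℕ) : Set where
  field
    blocks   : List ℕ
    size     : ℕ
    length≡  : length blocks ≡ t
    tiling   : Tiling p 0 (3 * p) blocks
    balanced : Balanced size blocks

layout-colouring : ∀ {p t} → 3 ≤ p → Layout p t → HasEqTreeColouring (K3 p) t 3
layout-colouring {p} 3≤p layout = subst (λ t → HasEqTreeColouring (K3 p) t 3) length≡
  (f , ((λ i → star-acyclic (K3 p) (star i)) , (λ v → star-degree (K3 p) v (s≤s z≤n) (star (f v)))) ,
   equitable)
  where
  open Layout layout
  v<sum : (v : Fin (3 * p)) → toℕ v < sum blocks
  v<sum v = subst (toℕ v <_) (sym (tiling-sum tiling)) (Finₚ.toℕ<n v)
  f : Fin (3 * p) → Fin (length blocks)
  f v = fromℕ< (blockOf-< blocks (v<sum v))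
  toℕ-f : ∀ v → toℕ (f v) ≡ blockOf blocks (toℕ v)
  toℕ-f v = Finₚ.toℕ-fromℕ< _
  class-size : ∀ i → classSize (K3 p) f i ≡ lookup blocks i
  class-size i = trans
    (length-filter-tabulate (λ v → f v Finₚ.≟ i) (3 * p) (λ v → v) (λ x → blockOf blocks x ≡ᵇ toℕ i)
      λ v → trans (does-⇔ (mk⇔ (cong toℕ) Finₚ.toℕ-injective) (f v Finₚ.≟ i) (toℕ (f v) ≟ toℕ i))
                  (cong (_≡ᵇ toℕ i) (toℕ-f v)))
    (trans (cong (count _) (sym (tiling-sum tiling))) (count-blockOf blocks i))
  star : ∀ i → Star (K3 p) 3 (λ v → f v ≡ i)
  star i = goodBlock-star 3≤p
    (λ {v} fv≡i → blockOf-window blocks i (v<sum v) (trans (sym (toℕ-f v)) (cong toℕ fv≡i)))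
    (tiling-lookup tiling i)
  size-bounds : ∀ i → size ≤ lookup blocks i × lookup blocks i ≤ suc size
  size-bounds i = All.lookup balanced (∈-lookup i)
  equitable : Equitable (K3 p) f
  equitable i j = subst₂ (λ a b → a ≤ b + 1) (sym (class-size i)) (sym (class-size j))
    (≤-trans (proj₂ (size-bounds i)) (subst (suc size ≤_) (+-comm 1 _) (s≤s (proj₁ (size-bounds j)))))


module _ {p : ℕ} where

  single-tiling : ∀ {a b ℓ} → GoodBlock p a ℓ → a + ℓ ≡ b → Tiling p a b [ ℓ ]
  single-tiling g refl = g ∷ []

  empty-tiling : ∀ {a b} → a + 0 ≡ b → Tiling p a b []
  empty-tiling {a} a+0≡b = subst (λ b → Tiling p a b []) (trans (sym (+-identityʳ a)) a+0≡b) []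

  inPart-tiling : ∀ q {a b} L → q * p ≤ a → b ≤ suc q * p → a + sum L ≡ b → Tiling p a b L
  inPart-tiling q     []      qp≤a b≤ a+0≡b = empty-tiling a+0≡b
  inPart-tiling q {a} (ℓ ∷ L) qp≤a b≤ end≡b =
    inPart q qp≤a (≤-trans (subst (a + ℓ ≤_) end≡b (+-monoʳ-≤ a (m≤m+n ℓ (sum L)))) b≤) ∷
    inPart-tiling q L (≤-trans qp≤a (m≤m+n a ℓ)) b≤ (trans (+-assoc a ℓ (sum L)) end≡b)

  part-tiling : ∀ q L → sum L ≡ p → Tiling p (q * p) (suc q * p) L
  part-tiling q L sum≡p = inPart-tiling q L ≤-refl ≤-refl (trans (cong (q * p +_) sum≡p) (+-comm (q * p) p))

  short-block-in : ∀ q {a ℓ} → ℓ ≤ 3 → q * p ≤ a → a < suc q * p → GoodBlock p a ℓ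
  short-block-in q {a} {ℓ} ℓ≤3 qp≤a a<B with a + ℓ ≤? suc q * p | suc a ≟ suc q * p
  ... | yes end≤B | _         = inPart q qp≤a end≤B
  ... | no  end≰B | yes a+1≡B =
    leftHub q a+1≡B (≤-trans (+-monoʳ-≤ a ℓ≤3) (subst (λ B → a + 3 ≤ B + 3) a+1≡B (n≤1+n (a + 3))))
  ... | no  end≰B | no  a+1≢B =
    rightHub q (≤-antisym end≤ (≰⇒> end≰B)) (<⇒≤ (<-≤-trans (≰⇒> end≰B) (+-monoʳ-≤ a ℓ≤3)))
    where
    end≤ : a + ℓ ≤ suc (suc q * p)
    end≤ = ≤-trans (+-monoʳ-≤ a ℓ≤3)
                   (subst (_≤ suc (suc q * p)) (+-comm 3 a) (s≤s (≤∧≢⇒< a<B a+1≢B)))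

  short-block : 3 ≤ p → ∀ a ℓ → ℓ ≤ 3 → GoodBlock p a ℓ
  short-block 3≤p a ℓ ℓ≤3 = short-block-in (a / p) ℓ≤3 (m/n*n≤m a p)
    (subst (_< suc (a / p) * p) (sym (m≡m%n+[m/n]*n a p)) (+-monoˡ-< (a / p * p) (m%n<n a p)))
    where instance _ = >-nonZero (≤-trans (s≤s z≤n) 3≤p)

  short-tiling : 3 ≤ p → ∀ {a b} L → All (_≤ 3) L → a + sum L ≡ b → Tiling p a b L
  short-tiling 3≤p     []      All.[]          a+0≡b = empty-tiling a+0≡b
  short-tiling 3≤p {a} (ℓ ∷ L) (ℓ≤3 All.∷ L≤3) end≡b =
    short-block 3≤p a ℓ ℓ≤3 ∷ short-tiling 3≤p L L≤3 (trans (+-assoc a ℓ (sum L)) end≡b)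

runs : List (ℕ × ℕ) → List ℕ
runs []              = []
runs ((k , ℓ) ∷ rs) = replicate k ℓ ++ runs rs

length-runs : ∀ rs → length (runs rs) ≡ sum (map proj₁ rs)
length-runs []              = refl
length-runs ((k , ℓ) ∷ rs) =
  trans (length-++ (replicate k ℓ)) (cong₂ _+_ (length-replicate k) (length-runs rs))

runs-balanced : ∀ {s} rs → All (λ r → s ≤ proj₂ r × proj₂ r ≤ suc s) rs → Balanced s (runs rs)
runs-balanced []              All.[]            = All.[]
runs-balanced ((k , ℓ) ∷ rs) (ℓ-bal All.∷ bal) =
  Allₚ.++⁺ (Allₚ.replicate⁺ k ℓ-bal) (runs-balanced rs bal)

balanced-split : ∀ {n s N} → n * s ≤ N → N ≤ n * suc s →
  ∃[ L ] length L ≡ n × sum L ≡ N × Balanced s L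
balanced-split {n} {s} {N} lo hi = L , length≡ , sum≡ , balanced
  where
  r : ℕ
  r = N ∸ n * s
  r≤n : r ≤ n
  r≤n = subst (r ≤_) (trans (cong (_∸ n * s) (*-suc n s)) (m+n∸n≡m n (n * s))) (∸-monoˡ-≤ (n * s) hi)
  L : List ℕ
  L = replicate r (suc s) ++ replicate (n ∸ r) s
  length≡ : length L ≡ n
  length≡ = trans (length-++ (replicate r (suc s)))
              (trans (cong₂ _+_ (length-replicate r) (length-replicate (n ∸ r))) (m+[n∸m]≡n r≤n))
  sum≡ : sum L ≡ N
  sum≡ = begin
    sum L                              ≡⟨ sum-++ (replicate r (suc s)) _ ⟩
    sum (replicate r (suc s)) + sum (replicate (n ∸ r) s)
                                       ≡⟨ cong₂ _+_ (sum-replicate r (suc s)) (sum-replicate (n ∸ r) s) ⟩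
    r * suc s + (n ∸ r) * s            ≡⟨ regroup r s (n ∸ r) ⟩
    r + (r + (n ∸ r)) * s              ≡⟨ cong (λ k → r + k * s) (m+[n∸m]≡n r≤n) ⟩
    r + n * s                          ≡⟨ +-comm r (n * s) ⟩
    n * s + r                          ≡⟨ m+[n∸m]≡n lo ⟩
    N                                  ∎
    where
    open ≡-Reasoning
    regroup : ∀ r s k → r * suc s + k * s ≡ r + (r + k) * s
    regroup = solve-∀
  balanced : Balanced s L
  balanced = Allₚ.++⁺ (Allₚ.replicate⁺ r (n≤1+n s , ≤-refl))
                      (Allₚ.replicate⁺ (n ∸ r) (≤-refl , n≤1+n s))

part-into-blocks : ∀ {p s a c x} → (a + c) * s ≤ p → p ≤ a * suc s → x ≤ c →
  ∃[ L ] length L ≡ a + x × sum L ≡ p × Balanced s L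
part-into-blocks {s = s} {a} {x = x} few many x≤c =
  balanced-split (≤-trans (*-monoˡ-≤ s (+-monoʳ-≤ a x≤c)) few)
                 (≤-trans many (*-monoˡ-≤ (suc s) (m≤m+n a x)))

aligned-layout : ∀ {p t} s a c → (a + c) * s ≤ p → p ≤ a * suc s →
  3 * a ≤ t → t ≤ 3 * (a + c) → Layout p t
aligned-layout s a c few many lo hi
  with d , refl ← ≤-offset lo
  with x , y , z , (x≤c , y≤c , z≤c) , x+y+z≡d
         ← split-into-three c d (+-cancelˡ-≤ (3 * a) d (3 * c) (subst (3 * a + d ≤_) (*-distribˡ-+ 3 a c) hi))
  with L₀ , len₀ , sum₀ , bal₀ ← part-into-blocks {a = a} few many x≤c
     | L₁ , len₁ , sum₁ , bal₁ ← part-into-blocks {a = a} few many y≤c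
     | L₂ , len₂ , sum₂ , bal₂ ← part-into-blocks {a = a} few many z≤c = record
  { blocks   = L₀ ++ L₁ ++ L₂
  ; size     = s
  ; length≡  = begin
      length (L₀ ++ L₁ ++ L₂)                 ≡⟨ length-++ L₀ ⟩
      length L₀ + length (L₁ ++ L₂)           ≡⟨ cong (length L₀ +_) (length-++ L₁) ⟩
      length L₀ + (length L₁ + length L₂)     ≡⟨ cong₂ _+_ len₀ (cong₂ _+_ len₁ len₂) ⟩
      (a + x) + ((a + y) + (a + z))           ≡⟨ solve (a ∷ x ∷ y ∷ z ∷ []) ⟩
      3 * a + (x + (y + z))                   ≡⟨ cong (3 * a +_) x+y+z≡d ⟩
      3 * a + d                               ∎
  ; tiling   = part-tiling 0 L₀ sum₀ ++ᵗ part-tiling 1 L₁ sum₁ ++ᵗ part-tiling 2 L₂ sum₂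
  ; balanced = Allₚ.++⁺ bal₀ (Allₚ.++⁺ bal₁ bal₂)
  }
  where open ≡-Reasoning

short-layout : ∀ {p t} → 3 ≤ p → p < t → Layout p t
short-layout {p} {t} 3≤p p<t = layout (balanced-split lower upper)
  where
  instance _ = >-nonZero (<-≤-trans (s≤s z≤n) p<t)
  s : ℕ
  s = 3 * p / t
  lower : t * s ≤ 3 * p
  lower = subst (_≤ 3 * p) (*-comm s t) (m/n*n≤m (3 * p) t)
  upper : 3 * p ≤ t * suc s
  upper = <⇒≤ (subst₂ _<_ (sym (m≡m%n+[m/n]*n (3 * p) t)) (*-comm (suc s) t)
                          (+-monoˡ-< (s * t) (m%n<n (3 * p) t)))
  s<3 : s < 3
  s<3 = m<n*o⇒m/o<n (*-monoʳ-< 3 p<t)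
  layout : ∃[ L ] length L ≡ t × sum L ≡ 3 * p × Balanced s L → Layout p t
  layout (L , len , sum≡ , bal) = record
    { blocks = L ; size = s ; length≡ = len ; balanced = bal
    ; tiling = short-tiling 3≤p L (All.map (λ bounds → ≤-trans (proj₂ bounds) s<3) bal) sum≡
    }

three-four-counts : ∀ N → 2 ≤ N →
  ∃[ Y ] ∃[ Z ] ∃[ δ ] δ ≤ N × Y * 3 ≡ N + δ × δ + Z * 3 ≡ N + N × Y + Z ≡ N
three-four-counts N 2≤N with Y , δ , δ≤2 , Y*3≡ ← round-up-to-three N =
  Y , N ∸ Y , δ , δ≤N , Y*3≡ , +-cancelˡ-≡ N _ _ gap , Y+Z≡N
  where
  δ≤N : δ ≤ N
  δ≤N = ≤-trans δ≤2 2≤N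
  Y≤N : Y ≤ N
  Y≤N = *-cancelʳ-≤ Y N 3 (begin
    Y * 3          ≡⟨ Y*3≡ ⟩
    N + δ          ≤⟨ +-monoʳ-≤ N δ≤N ⟩
    N + N          ≤⟨ m≤m+n (N + N) N ⟩
    N + N + N      ≡⟨ solve (N ∷ []) ⟩
    N * 3          ∎)
    where open ≤-Reasoning
  Y+Z≡N : Y + (N ∸ Y) ≡ N
  Y+Z≡N = m+[n∸m]≡n Y≤N
  gap : N + (δ + (N ∸ Y) * 3) ≡ N + (N + N)
  gap = begin
    N + (δ + (N ∸ Y) * 3)     ≡⟨ +-assoc N δ _ ⟨
    N + δ + (N ∸ Y) * 3       ≡⟨ cong (_+ (N ∸ Y) * 3) Y*3≡ ⟨
    Y * 3 + (N ∸ Y) * 3       ≡⟨ *-distribʳ-+ 3 Y (N ∸ Y) ⟨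
    (Y + (N ∸ Y)) * 3         ≡⟨ cong (_* 3) Y+Z≡N ⟩
    N * 3                     ≡⟨ solve (N ∷ []) ⟩
    N + (N + N)               ∎
    where open ≡-Reasoning

-- The e 4-blocks of the three parts start at 0, p + δ and 3p − 4e; runs of Y and Z 3-blocks, which
-- may cross part boundaries, fill the gaps of lengths N + δ and 2N − δ, where δ ≤ 2 makes 3 ∣ N + δ.
three-four-layout : ∀ e N → 3 ≤ 4 * e + N → 2 ≤ N → Layout (4 * e + N) (3 * e + N)
three-four-layout e N 3≤p 2≤N
  with Y , Z , δ , δ≤N , Y*3≡ , δ+Z*3≡ , Y+Z≡N ← three-four-counts N 2≤N = record
  { blocks   = runs rs
  ; size     = 3
  ; length≡  = trans (length-runs rs) length≡
  ; tiling   = first ++ᵗ gap₁ ++ᵗ second ++ᵗ gap₂ ++ᵗ third ++ᵗ []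
  ; balanced = runs-balanced rs (four All.∷ three All.∷ four All.∷ three All.∷ four All.∷ All.[])
  }
  where
  rs : List (ℕ × ℕ)
  rs = (e , 4) ∷ (Y , 3) ∷ (e , 4) ∷ (Z , 3) ∷ (e , 4) ∷ []
  three : 3 ≤ 3 × 3 ≤ 4
  three = ≤-refl , n≤1+n 3
  four : 3 ≤ 4 × 4 ≤ 4
  four = n≤1+n 3 , ≤-refl
  fours : List ℕ
  fours = replicate e 4
  threes≤3 : ∀ k → All (_≤ 3) (replicate k 3)
  threes≤3 k = Allₚ.replicate⁺ k ≤-refl
  length≡ : e + (Y + (e + (Z + (e + 0)))) ≡ 3 * e + N
  length≡ = begin
    e + (Y + (e + (Z + (e + 0))))  ≡⟨ solve (e ∷ Y ∷ Z ∷ []) ⟩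
    3 * e + (Y + Z)                ≡⟨ cong (3 * e +_) Y+Z≡N ⟩
    3 * e + N                      ∎
    where open ≡-Reasoning
  first : Tiling (4 * e + N) 0 (e * 4) fours
  first = inPart-tiling 0 fours z≤n (m+k≡n⇒m≤n N (solve (e ∷ N ∷ []))) (sum-replicate e 4)
  gap₁ : Tiling (4 * e + N) (e * 4) (4 * e + N + δ) (replicate Y 3)
  gap₁ = short-tiling 3≤p (replicate Y 3) (threes≤3 Y)
    (trans (cong (e * 4 +_) (trans (sum-replicate Y 3) Y*3≡)) (solve (e ∷ N ∷ δ ∷ [])))
  second : Tiling (4 * e + N) (4 * e + N + δ) (4 * e + N + δ + e * 4) fours
  second = inPart-tiling 1 fours (m+k≡n⇒m≤n δ (solve (e ∷ N ∷ δ ∷ [])))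
    (≤-trans (+-monoˡ-≤ (e * 4) (+-monoʳ-≤ (4 * e + N) δ≤N)) (≤-reflexive two-parts))
    (cong (4 * e + N + δ +_) (sum-replicate e 4))
    where
    two-parts : 4 * e + N + N + e * 4 ≡ 2 * (4 * e + N)
    two-parts = solve (e ∷ N ∷ [])
  gap₂ : Tiling (4 * e + N) (4 * e + N + δ + e * 4) (2 * (4 * e + N) + N) (replicate Z 3)
  gap₂ = short-tiling 3≤p (replicate Z 3) (threes≤3 Z) (begin
    4 * e + N + δ + e * 4 + sum (replicate Z 3)  ≡⟨ cong (4 * e + N + δ + e * 4 +_) (sum-replicate Z 3) ⟩
    4 * e + N + δ + e * 4 + Z * 3                ≡⟨ solve (e ∷ N ∷ δ ∷ Z ∷ []) ⟩
    e * 8 + N + (δ + Z * 3)                      ≡⟨ cong (e * 8 + N +_) δ+Z*3≡ ⟩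
    e * 8 + N + (N + N)                          ≡⟨ solve (e ∷ N ∷ []) ⟩
    2 * (4 * e + N) + N                          ∎)
    where open ≡-Reasoning
  third : Tiling (4 * e + N) (2 * (4 * e + N) + N) (3 * (4 * e + N)) fours
  third = inPart-tiling 2 fours (m≤m+n (2 * (4 * e + N)) N) ≤-refl
    (trans (cong (2 * (4 * e + N) + N +_) (sum-replicate e 4)) (solve (e ∷ N ∷ [])))

-- For p = 4k + 2 and t = 3k + 1 we have 3p = 4t + 2: only two blocks of size 5, too few to write
-- every part as a sum of 4s and 5s, so two 4-blocks straddle part boundaries as stars K_{1,3}.
crossing-layout : ∀ j → Layout (4 * suc j + 2) (3 * suc j + 1)
crossing-layout j = record
  { blocks   = runs rs
  ; size     = 4
  ; length≡  = trans (length-runs rs) length≡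
  ; tiling   = t₁ ++ᵗ t₂ ++ᵗ t₃ ++ᵗ t₄ ++ᵗ t₅ ++ᵗ t₆ ++ᵗ t₇ ++ᵗ []
  ; balanced = runs-balanced rs
      (five All.∷ four All.∷ four All.∷ four All.∷ four All.∷ five All.∷ four All.∷ All.[])
  }
  where
  rs : List (ℕ × ℕ)
  rs = (1 , 5) ∷ (j , 4) ∷ (1 , 4) ∷ (j , 4) ∷ (1 , 4) ∷ (1 , 5) ∷ (j , 4) ∷ []
  four : 4 ≤ 4 × 4 ≤ 5
  four = ≤-refl , n≤1+n 4
  five : 4 ≤ 5 × 5 ≤ 5
  five = n≤1+n 4 , ≤-refl
  length≡ : 1 + (j + (1 + (j + (1 + (1 + (j + 0)))))) ≡ 3 * suc j + 1
  length≡ = solve (j ∷ [])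
  fours-from : ∀ a → a + sum (replicate j 4) ≡ a + j * 4
  fours-from a = cong (a +_) (sum-replicate j 4)
  t₁ : Tiling (4 * suc j + 2) 0 5 (5 ∷ [])
  t₁ = single-tiling (inPart 0 z≤n (m+k≡n⇒m≤n (4 * j + 1) (solve (j ∷ [])))) refl
  t₂ : Tiling (4 * suc j + 2) 5 (4 * j + 5) (replicate j 4)
  t₂ = inPart-tiling 0 _ z≤n (m+k≡n⇒m≤n 1 (solve (j ∷ []))) (trans (fours-from 5) (solve (j ∷ [])))
  t₃ : Tiling (4 * suc j + 2) (4 * j + 5) (4 * j + 9) (4 ∷ [])
  t₃ = single-tiling (leftHub 0 (solve (j ∷ [])) (≤-reflexive (solve (j ∷ [])))) (solve (j ∷ []))
  t₄ : Tiling (4 * suc j + 2) (4 * j + 9) (8 * j + 9) (replicate j 4)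
  t₄ = inPart-tiling 1 _ (m+k≡n⇒m≤n 3 (solve (j ∷ []))) (m+k≡n⇒m≤n 3 (solve (j ∷ [])))
                     (trans (fours-from (4 * j + 9)) (solve (j ∷ [])))
  t₅ : Tiling (4 * suc j + 2) (8 * j + 9) (8 * j + 13) (4 ∷ [])
  t₅ = single-tiling (rightHub 1 (solve (j ∷ [])) (≤-reflexive (solve (j ∷ [])))) (solve (j ∷ []))
  t₆ : Tiling (4 * suc j + 2) (8 * j + 13) (8 * j + 18) (5 ∷ [])
  t₆ = single-tiling (inPart 2 (m+k≡n⇒m≤n 1 (solve (j ∷ []))) (m+k≡n⇒m≤n (4 * j) (solve (j ∷ []))))
                     (solve (j ∷ []))
  t₇ : Tiling (4 * suc j + 2) (8 * j + 18) (3 * (4 * suc j + 2)) (replicate j 4)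
  t₇ = inPart-tiling 2 _ (m+k≡n⇒m≤n 6 (solve (j ∷ []))) ≤-refl
                     (trans (fours-from (8 * j + 18)) (solve (j ∷ [])))

private
  4k+2≡3k+2+k : ∀ k → 4 * k + 2 ≡ 3 * k + 2 + k
  4k+2≡3k+2+k = solve-∀

three-four-range : ∀ k {t} → 1 ≤ k → 3 * k + 2 ≤ t → t ≤ 4 * k + 2 → Layout (4 * k + 2) t
three-four-range k 1≤k lo hi
  with d , refl ← ≤-offset lo
  with e , refl ← ≤-offset (+-cancelˡ-≤ (3 * k + 2) d k (subst (3 * k + 2 + d ≤_) (4k+2≡3k+2+k k) hi)) =
  subst₂ Layout p≡ t≡ (three-four-layout e (4 * d + 2) (subst (3 ≤_) (sym p≡) 3≤p) (m≤n+m 2 (4 * d)))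
  where
  p≡ : 4 * e + (4 * d + 2) ≡ 4 * (d + e) + 2
  p≡ = solve (d ∷ e ∷ [])
  t≡ : 3 * e + (4 * d + 2) ≡ 3 * (d + e) + 2 + d
  t≡ = solve (d ∷ e ∷ [])
  3≤p : 3 ≤ 4 * (d + e) + 2
  3≤p = ≤-trans (s≤s (s≤s (s≤s z≤n))) (+-monoˡ-≤ 2 (*-monoʳ-≤ 4 1≤k))

-- Here suc m is the m of the statement, p = 20m + 10. A part splits into n blocks of sizes 5 and 6
-- for 4m + 1 ≤ n ≤ 4m + 2 (this needs m ≥ 1), and into n blocks of sizes 4 and 5 for
-- 4m + 2 ≤ n ≤ 5m + 2.
aligned-range : ∀ m {t} → 12 * suc m + 3 ≤ t → t ≤ 3 * (5 * suc m + 2) → Layout (4 * (5 * suc m + 2) + 2) t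
aligned-range m {t} lo hi with t ≤? 3 * (4 * suc m + 1 + 1)
... | yes t≤ = aligned-layout 5 (4 * suc m + 1) 1 (≤-reflexive fives) (m+k≡n⇒m≤n (4 * m) sixes)
                 (≤-trans (≤-reflexive low) lo) t≤
  where
  fives : (4 * suc m + 1 + 1) * 5 ≡ 4 * (5 * suc m + 2) + 2
  fives = solve (m ∷ [])
  sixes : 4 * (5 * suc m + 2) + 2 + 4 * m ≡ (4 * suc m + 1) * 6
  sixes = solve (m ∷ [])
  low : 3 * (4 * suc m + 1) ≡ 12 * suc m + 3
  low = solve (m ∷ [])
... | no  t≰ = aligned-layout 4 (4 * suc m + 2) (suc m) (m+k≡n⇒m≤n 2 fours) (≤-reflexive fives)
                 (<⇒≤ (subst (_< t) (cong (3 *_) (+-assoc (4 * suc m) 1 1)) (≰⇒> t≰)))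
                 (≤-trans hi (≤-reflexive high))
  where
  fours : (4 * suc m + 2 + suc m) * 4 + 2 ≡ 4 * (5 * suc m + 2) + 2
  fours = solve (m ∷ [])
  fives : 4 * (5 * suc m + 2) + 2 ≡ (4 * suc m + 2) * 5
  fives = solve (m ∷ [])
  high : 3 * (5 * suc m + 2) ≡ 3 * (4 * suc m + 2 + suc m)
  high = solve (m ∷ [])

3≤part-size : ∀ m → 3 ≤ 4 * (5 * suc m + 2) + 2
3≤part-size m = m+k≡n⇒m≤n (20 * m + 27) (solve (m ∷ []))

layout-for : ∀ m t → 12 * suc m + 3 ≤ t → Layout (4 * (5 * suc m + 2) + 2) t
layout-for m t lo
  with t ≤? 3 * (5 * suc m + 2) | 3 * (5 * suc m + 2) + 1 ≟ t | t ≤? 4 * (5 * suc m + 2) + 2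
... | yes t≤3k | _        | _       = aligned-range m lo t≤3k
... | no  _    | yes refl | _       = crossing-layout (m + 4 * suc m + 2)
... | no  t≰3k | no  t≢   | yes t≤p =
  three-four-range (5 * suc m + 2) (s≤s z≤n)
    (subst (_≤ t) (sym (+-suc (3 * (5 * suc m + 2)) 1))
      (≤∧≢⇒< (subst (_≤ t) (+-comm 1 (3 * (5 * suc m + 2))) (≰⇒> t≰3k)) t≢))
    t≤p
... | no  _    | no  _    | no  t≰p = short-layout (3≤part-size m) (≰⇒> t≰p)

lemma26 : (m k : ℕ) → 2 ≤ m → k ≡ 5 * m + 2 →
    StrongEqVertexArboricity≤ (K3 (4 * k + 2)) 3 (12 * m + 3)
lemma26 zero    k () refl
lemma26 (suc m) k _  refl =
  12 * suc m + 3 , ≤-refl , λ t lo → layout-colouring (3≤part-size m) (layout-for m t lo)
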